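{- Let $G$ be a finite connected plane graph (multi-edges allowed, no loops), let $q$ be a vertex on its infinite face, and let $T_0$ be a spanning tree of $G$. Then for every spanning tree $T$ of $G$, $$\Psi_{T_0}(M_T) \;=\; \Big[\sum_{e\in E(G):\ e \text{ is oriented differently in } O_T \text{ and } O_{T_0}} w_e\Big]\in K_{T_0}.$$ That is, $\Psi_{T_0}$ agrees with the map that places a $1$ on (the white vertex of) each edge of $G$ whose orientation changes between $O_{T_0}$ and $O_T$.
   Context: Construction of $G^+$. $G$ is a finite connected plane graph (multi-edges allowed, no self-loops), $q$ is a vertex of $G$ incident to the infinite face, $G^\vee$ is the planar dual, and $q^*$ is the dual vertex of the infinite face. Draw $G$ and $G^\vee$ together, each edge $e$ of $G$ crossing exactly its dual edge $e^*$. At each crossing point add a new "white" vertex $w_e$. Each edge of $G$ and each edge of $G^\vee$ is thereby subdivided into two half-edges. Now delete $q$, $q^*$, and all half-edges incident to them. The resulting plane bipartite graph is $G^+$. Its white vertices are the $w_e$, $e\in E(G)$. Its black vertices are the vertices of $G$ other than $q$ and the vertices of $G^\vee$ other than $q^*$. Its edges are the remaining half-edges. $M(G^+)$ denotes its set of perfect matchings. $q$-connected orientation of a spanning tree. For a spanning tree $T$ of $G$, the orientation $O_T$ of $G$ is defined as follows. Edges of $T$ are oriented away from $q$. Each edge $e\notin T$ is oriented so that following $e$ traverses its fundamental cycle (the unique cycle in $T\cup\{e\}$) counterclockwise. Induced orientation of $G^+$ from $T$. Each half-edge of $e\in E(G)$ is oriented in the direction of $e$ in $O_T$. Each dual edge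 $e^*$ is oriented so that its direction is obtained from that of $e$ by a counterclockwise quarter-turn at the crossing (so $e^*$ crosses $e$ from the right side of $e$ to its left side). Its half-edges inherit this direction. An edge of $G^+$ is called positively oriented if it is oriented white $\to$ black, and negatively oriented otherwise. Temperley matching. $M_T$ consists of one edge at each white vertex $w_e$, using the orientation induced from $T$. If $e\in T$, take the half-edge of $e$ leaving $w_e$. If $e\notin T$, take the half-edge of $e^*$ leaving $w_e$. This is a perfect matching of $G^+$, and $T\mapsto M_T$ is a bijection onto $M(G^+)$. Kasteleyn cokernel. Let $W$ be the set of white vertices. For each black vertex $b$, define $r_b\in\mathbb{Z}^W$ by letting $r_b(w)$ be the number of edges between $b$ and $w$ oriented $b\to w$ minus the number oriented $w\to b$, in the orientation induced from $T_0$. Define $K_{T_0}=\mathbb{Z}^W/\langle r_b : b\text{ black}\rangle$. The class of $x\in\mathbb{Z}^W$ is written $[x]$, and $w_e$ also denotes the corresponding basis vector of $\mathbb{Z}^W$. The map $\Psi_{T_0}$. For $M\in M(G^+)$, let $L=M_{T_0}\triangle M$. Define a divisor on $W$ as follows. At a white vertex $w$ covered by $L$, put $1$ if of the two edges of $L$ at $w$ one is positively and the other negatively oriented (orientation induced from $T_0$), and put $0$ otherwise. Put $0$ at white vertices not covered by $L$. Then $\Psi_{T_0}(M)$ is the class of this divisor in $K_{T_0}$. -}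

module Defs where

open import Data.Nat using (ℕ; zero; suc; _+_)
open import Data.Fin using (Fin)
open import Data.Fin.Properties using () renaming (_≟_ to _≟ᶠ_)
open import Data.Bool using (Bool; true; false; not; if_then_else_; _xor_)
open import Data.Bool.Properties using () renaming (_≟_ to _≟ᵇ_)
open import Data.Product using (Σ; ∃; ∃-syntax; _×_; _,_; proj₁; proj₂)
import Data.Product.Properties as ×P
open import Data.Sum using (_⊎_; inj₁; inj₂)
import Data.Sum.Properties as ⊎P
open import Data.List using (List; []; _∷_; _++_; map; foldr; allFin)
open import Data.List.Membership.Propositional using (_∈_)
open import Data.List.Relation.Unary.All using (All)
open import Data.List.Relation.Unary.Unique.Propositional using (Unique)
open import Data.Integer using (ℤ; 0ℤ; 1ℤ; -1ℤ; _*_; _-_) renaming (_+_ to _+ℤ_)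
open import Relation.Binary.PropositionalEquality using (_≡_; _≢_; refl)
open import Relation.Nullary using (¬_; Dec; yes; no)
open import Relation.Nullary.Decidable using (⌊_⌋)
open import Function using (_∘_)

-- Combinatorial maps (rotation systems) encoding plane multigraphs.
-- Edges are Fin m; each edge e has two darts (e , true) and (e , false).

Dart : ℕ → Set
Dart m = Fin m × Bool

rev : ∀ {m} → Dart m → Dart m
rev (e , b) = e , not b

edgeOf : ∀ {m} → Dart m → Fin m
edgeOf = proj₁

_≟ᵈ_ : ∀ {m} (d d' : Dart m) → Dec (d ≡ d')
_≟ᵈ_ = ×P.≡-dec _≟ᶠ_ _≟ᵇ_

iter : ∀ {A : Set} → ℕ → (A → A) → A → A
iter zero f x = x
iter (suc k) f x = f (iter k f x)

SameOrbit : ∀ {A : Set} → (A → A) → A → A → Set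
SameOrbit f x y = ∃[ k ] iter k f x ≡ y

-- Walks: a list of darts, each starting where the previous one ends
-- (tl d = tail vertex of dart d, tl (rev d) = its head).
data Walk {n m : ℕ} (tl : Dart m → Fin n) : Fin n → List (Dart m) → Fin n → Set where
  stop : ∀ {u} → Walk tl u [] u
  step : ∀ {u v d ds} → tl d ≡ u → Walk tl (tl (rev d)) ds v → Walk tl u (d ∷ ds) v

-- A finite connected plane multigraph without loops, given by a rotation
-- system: cw d is the next dart clockwise around the tail of d.  The face on
-- the left of a dart d is leftFace d; faces are exactly the orbits of
-- cw ∘ rev.  Euler's formula (V - E + F = 2) for the connected map says the
-- embedding is on the sphere, i.e. the map is a plane graph.
record PlaneGraph (n m F : ℕ) : Set where
  field
    tail         : Dart m → Fin n
    cw           : Dart m → Dart m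
    leftFace     : Dart m → Fin F
    cw-injective : ∀ d d' → cw d ≡ cw d' → d ≡ d'
    vertexOrbit→ : ∀ d d' → tail d ≡ tail d' → SameOrbit cw d d'
    vertexOrbit← : ∀ d d' → SameOrbit cw d d' → tail d ≡ tail d'
    faceOrbit→   : ∀ d d' → leftFace d ≡ leftFace d' → SameOrbit (cw ∘ rev) d d'
    faceOrbit←   : ∀ d d' → SameOrbit (cw ∘ rev) d d' → leftFace d ≡ leftFace d'
    faceSurj     : m ≡ 0 ⊎ (∀ f → ∃[ d ] leftFace d ≡ f)
    noLoops      : ∀ e → tail (e , true) ≢ tail (e , false)
    connected    : ∀ u v → ∃[ ds ] Walk tail u ds v
    euler        : n + F ≡ m + 2

  head : Dart m → Fin n
  head d = tail (rev d)

Σℤ : ∀ {k} → (Fin k → ℤ) → ℤ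
Σℤ {k} f = foldr _+ℤ_ 0ℤ (map f (allFin k))

module _ {n m F : ℕ} (G : PlaneGraph n m F) where
  open PlaneGraph G

  OnFace : Fin n → Fin F → Set
  OnFace q f∞ = m ≡ 0 ⊎ (∃[ d ] tail d ≡ q × leftFace d ≡ f∞)

  InT : (Fin m → Bool) → List (Dart m) → Set
  InT T ds = All (λ d → T (edgeOf d) ≡ true) ds

  Path : Fin n → List (Dart m) → Fin n → Set
  Path u ds v = Walk tail u ds v × Unique (u ∷ map head ds)

  Cycle : Fin n → List (Dart m) → Set
  Cycle u ds = Walk tail u ds u × ds ≢ [] × Unique (map edgeOf ds) × Unique (map tail ds)

  IsSpanningTree : (Fin m → Bool) → Set
  IsSpanningTree T =
    (∀ u v → ∃[ ds ] Walk tail u ds v × InT T ds) ×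
    (¬ (∃[ u ] ∃[ ds ] Cycle u ds × InT T ds))

  data FReach (C : Fin m → Set) (f : Fin F) : Fin F → Set where
    here  : FReach C f f
    cross : ∀ {d} → ¬ C (edgeOf d) → FReach C f (leftFace (rev d)) → FReach C f (leftFace d)

  module _ (q : Fin n) (f∞ : Fin F) where

    -- tree edge oriented away from q: d is the last dart of a T-path from q
    AwayFromQ : (Fin m → Bool) → Dart m → Set
    AwayFromQ T d = ∃[ ds ] Path q (ds ++ d ∷ []) (head d) × InT T (ds ++ d ∷ [])

    -- non-tree edge: following d traverses its fundamental cycle
    -- (d followed by the T-path from head d back to tail d)
    -- counterclockwise, i.e. the face on the left of d lies in the interior
    -- (not reachable from the infinite face without crossing the cycle)
    CCW : (Fin m → Bool) → Dart m → Set
    CCW T d = ∃[ P ] Path (head d) P (tail d) × InT T P ×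
      (¬ FReach (λ e' → e' ≡ edgeOf d ⊎ e' ∈ map edgeOf P) f∞ (leftFace d))

    -- o is the q-connected orientation O_T: o e is the dart giving e's direction
    IsOT : (Fin m → Bool) → (Fin m → Dart m) → Set
    IsOT T o = ∀ e → edgeOf (o e) ≡ e ×
      (T e ≡ true → AwayFromQ T (o e)) × (T e ≡ false → CCW T (o e))

    -- Half-edges of G⁺: primal d joins w_(edgeOf d) to vertex tail d;
    -- dual d joins w_(edgeOf d) to face leftFace d.
    data HalfEdge : Set where
      primal : Dart m → HalfEdge
      dual   : Dart m → HalfEdge

    _≟ʰ_ : (h h' : HalfEdge) → Dec (h ≡ h')
    primal d ≟ʰ primal d' with d ≟ᵈ d'
    ... | yes refl = yes refl
    ... | no ne = no λ { refl → ne refl }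
    primal d ≟ʰ dual d' = no λ ()
    dual d ≟ʰ primal d' = no λ ()
    dual d ≟ʰ dual d' with d ≟ᵈ d'
    ... | yes refl = yes refl
    ... | no ne = no λ { refl → ne refl }

    whiteOf : HalfEdge → Fin m
    whiteOf (primal d) = edgeOf d
    whiteOf (dual d) = edgeOf d

    blackOf : HalfEdge → Fin n ⊎ Fin F
    blackOf (primal d) = inj₁ (tail d)
    blackOf (dual d) = inj₂ (leftFace d)

    -- positively oriented (white → black) in the orientation induced from o
    -- (e* is e rotated a quarter turn counterclockwise: from the right face
    -- leftFace (rev (o e)) to the left face leftFace (o e)).
    positive : (Fin m → Dart m) → HalfEdge → Bool
    positive o (primal d) = not ⌊ d ≟ᵈ o (edgeOf d) ⌋
    positive o (dual d) = ⌊ d ≟ᵈ o (edgeOf d) ⌋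

    -- Temperley matching M_T, as the choice of matched half-edge at each w_e
    MT : (Fin m → Bool) → (Fin m → Dart m) → Fin m → HalfEdge
    MT T o e = if T e then primal (rev (o e)) else dual (o e)

    -- r_b(w): #(b → w) - #(w → b), over half-edges of w at b
    contrib : (Fin m → Dart m) → Fin n ⊎ Fin F → HalfEdge → ℤ
    contrib o b h with ⌊ ⊎P.≡-dec _≟ᶠ_ _≟ᶠ_ (blackOf h) b ⌋
    ... | false = 0ℤ
    ... | true = if positive o h then -1ℤ else 1ℤ

    r : (Fin m → Dart m) → Fin n ⊎ Fin F → Fin m → ℤ
    r o b w = contrib o b (primal (w , true)) +ℤ contrib o b (primal (w , false))
           +ℤ contrib o b (dual (w , true)) +ℤ contrib o b (dual (w , false))

    -- equality in K_{T₀} = ℤ^W / ⟨ r_b : b black ⟩, black = V∖{q} ⊎ F∖{f∞}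
    KEq : (Fin m → Dart m) → (Fin m → ℤ) → (Fin m → ℤ) → Set
    KEq o x y = Σ (Fin n → ℤ) λ cv → Σ (Fin F → ℤ) λ cf → ∀ w →
      x w - y w ≡
        Σℤ (λ v → if ⌊ v ≟ᶠ q ⌋ then 0ℤ else cv v * r o (inj₁ v) w)
        +ℤ Σℤ (λ f → if ⌊ f ≟ᶠ f∞ ⌋ then 0ℤ else cf f * r o (inj₂ f) w)

    -- divisor defining Ψ_{T₀}(M), for a matching M given by its edge at each
    -- white vertex; M₀ = M_{T₀}, o₀ = O_{T₀}
    ΨDiv : (Fin m → Dart m) → (Fin m → HalfEdge) → (Fin m → HalfEdge) → Fin m → ℤ
    ΨDiv o₀ M₀ M w =
      if ⌊ M₀ w ≟ʰ M w ⌋ then 0ℤ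
      else (if positive o₀ (M₀ w) xor positive o₀ (M w) then 1ℤ else 0ℤ)

    flipDiv : (Fin m → Dart m) → (Fin m → Dart m) → Fin m → ℤ
    flipDiv o₀ o w = if ⌊ o w ≟ᵈ o₀ w ⌋ then 0ℤ else 1ℤ

module Submission where

-- The divisor defining Ψ_{T₀}(M_T) coincides, white vertex by white vertex,
-- with the divisor marking the edges whose orientation differs in O_T and
-- O_{T₀}; hence the two classes in K_{T₀} agree (the difference is the zero
-- combination of the relations r_b).
--
-- The pointwise identity rests on one observation about Temperley
-- matchings: the half-edge that M_T picks at w_e leaves w_e in the
-- orientation induced from T, so in the orientation induced from T₀ it is
-- positive exactly when e is oriented the same way in O_T and O_{T₀}
-- (lemma temperley-sign).  Taking T = T₀, the edge of M_{T₀} is always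
-- positive.  At w_e the symmetric difference either does not cover w_e
-- (then both matchings use the same half-edge, so e keeps its orientation)
-- or the divisor is 1 iff the two signs differ, i.e. iff e flips.

open import Defs
open import Data.Nat using (ℕ)
open import Data.Fin using (Fin) renaming (_≟_ to _≟ᶠ_)
open import Data.Bool using (Bool; true; false; not; if_then_else_; _xor_)
open import Data.Bool.Properties using (not-¬; not-involutive; if-not)
open import Data.Empty using (⊥-elim)
open import Data.Product using (_,_; proj₁; proj₂)
open import Data.Sum using (inj₁; inj₂)
open import Data.List using (List; []; _∷_; map; foldr; allFin)
open import Data.Integer using (ℤ; 0ℤ; 1ℤ; _-_; _*_) renaming (_+_ to _+ℤ_)
open import Data.Integer.Properties using (i≡j⇒i-j≡0; *-zeroˡ)
open import Relation.Binary.PropositionalEquality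
open import Relation.Nullary using (Dec; yes; no; ¬_)
open import Relation.Nullary.Decidable using (⌊_⌋; isYes≗does; dec-true; dec-false)

⌊⌋-true : ∀ {P : Set} (P? : Dec P) → P → ⌊ P? ⌋ ≡ true
⌊⌋-true P? p = trans (isYes≗does P?) (dec-true P? p)

⌊⌋-false : ∀ {P : Set} (P? : Dec P) → ¬ P → ⌊ P? ⌋ ≡ false
⌊⌋-false P? ¬p = trans (isYes≗does P?) (dec-false P? ¬p)

rev-≢ : ∀ {m} (d : Dart m) → rev d ≢ d
rev-≢ (e , b) eq = not-¬ refl (sym (cong proj₂ eq))

other-dart : ∀ {m} (d d₀ : Dart m) → edgeOf d ≡ edgeOf d₀ → d ≢ d₀ → rev d ≡ d₀
other-dart (e , true)  (.e , true)  refl d≢d₀ = ⊥-elim (d≢d₀ refl)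
other-dart (e , true)  (.e , false) refl _ = refl
other-dart (e , false) (.e , true)  refl _ = refl
other-dart (e , false) (.e , false) refl d≢d₀ = ⊥-elim (d≢d₀ refl)

rev-test : ∀ {m} (d d₀ : Dart m) → edgeOf d ≡ edgeOf d₀ →
  ⌊ rev d ≟ᵈ d₀ ⌋ ≡ not ⌊ d ≟ᵈ d₀ ⌋
rev-test d d₀ same-edge with d ≟ᵈ d₀
... | yes refl = ⌊⌋-false (rev d ≟ᵈ d) (rev-≢ d)
... | no d≢d₀ = ⌊⌋-true (rev d ≟ᵈ d₀) (other-dart d d₀ same-edge d≢d₀)

sum-zeros : ∀ {A : Set} (f : A → ℤ) → (∀ a → f a ≡ 0ℤ) →
  (xs : List A) → foldr _+ℤ_ 0ℤ (map f xs) ≡ 0ℤ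
sum-zeros f f≡0 [] = refl
sum-zeros f f≡0 (x ∷ xs) = cong₂ _+ℤ_ (f≡0 x) (sum-zeros f f≡0 xs)

Σℤ-zeros : ∀ {k} (f : Fin k → ℤ) → (∀ i → f i ≡ 0ℤ) → Σℤ f ≡ 0ℤ
Σℤ-zeros {k} f f≡0 = sum-zeros f f≡0 (allFin k)

zero-coefficient : (excluded : Bool) (x : ℤ) → (if excluded then 0ℤ else 0ℤ * x) ≡ 0ℤ
zero-coefficient true x = refl
zero-coefficient false x = *-zeroˡ x

module _ {n m F : ℕ} (G : PlaneGraph n m F) (q : Fin n) (f∞ : Fin F) where

  -- Divisors that agree at every white vertex have the same class in K:
  -- their difference is the combination of the r_b with all coefficients 0.
  KEq-pointwise : (o₀ : Fin m → Dart m) (x y : Fin m → ℤ) →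
    (∀ w → x w ≡ y w) → KEq G q f∞ o₀ x y
  KEq-pointwise o₀ x y x≡y = (λ _ → 0ℤ) , (λ _ → 0ℤ) , λ w → begin
      x w - y w
    ≡⟨ i≡j⇒i-j≡0 (x≡y w) ⟩
      0ℤ
    ≡⟨ sym (cong₂ _+ℤ_
         (Σℤ-zeros _ (λ v → zero-coefficient ⌊ v ≟ᶠ q ⌋ (r G q f∞ o₀ (inj₁ v) w)))
         (Σℤ-zeros _ (λ f → zero-coefficient ⌊ f ≟ᶠ f∞ ⌋ (r G q f∞ o₀ (inj₂ f) w)))) ⟩
      Σℤ (λ v → if ⌊ v ≟ᶠ q ⌋ then 0ℤ else 0ℤ * r G q f∞ o₀ (inj₁ v) w)
        +ℤ Σℤ (λ f → if ⌊ f ≟ᶠ f∞ ⌋ then 0ℤ else 0ℤ * r G q f∞ o₀ (inj₂ f) w)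
    ∎
    where open ≡-Reasoning

  -- The half-edge chosen by M_T at w_e leaves w_e in the orientation o of e
  -- (from T); in the orientation o₀ it is positive iff o and o₀ agree on e.
  temperley-sign : (T : Fin m → Bool) (o o₀ : Fin m → Dart m) (w : Fin m) →
    edgeOf (o w) ≡ w → edgeOf (o₀ w) ≡ w →
    positive G q f∞ o₀ (MT G q f∞ T o w) ≡ ⌊ o w ≟ᵈ o₀ w ⌋
  temperley-sign T o o₀ w o-on-w o₀-on-w with T w
  ... | true = begin
      not ⌊ rev (o w) ≟ᵈ o₀ (edgeOf (o w)) ⌋
    ≡⟨ cong (λ e → not ⌊ rev (o w) ≟ᵈ o₀ e ⌋) o-on-w ⟩
      not ⌊ rev (o w) ≟ᵈ o₀ w ⌋
    ≡⟨ cong not (rev-test (o w) (o₀ w) (trans o-on-w (sym o₀-on-w))) ⟩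
      not (not ⌊ o w ≟ᵈ o₀ w ⌋)
    ≡⟨ not-involutive _ ⟩
      ⌊ o w ≟ᵈ o₀ w ⌋
    ∎
    where open ≡-Reasoning
  ... | false = cong (λ e → ⌊ o w ≟ᵈ o₀ e ⌋) o-on-w

  temperley-positive : (T : Fin m → Bool) (o : Fin m → Dart m) (w : Fin m) →
    edgeOf (o w) ≡ w → positive G q f∞ o (MT G q f∞ T o w) ≡ true
  temperley-positive T o w o-on-w =
    trans (temperley-sign T o o w o-on-w o-on-w) (⌊⌋-true (o w ≟ᵈ o w) refl)

  Ψ-flip-pointwise : (T₀ T : Fin m → Bool) (o₀ o : Fin m → Dart m) (w : Fin m) →
    edgeOf (o₀ w) ≡ w → edgeOf (o w) ≡ w →
    ΨDiv G q f∞ o₀ (MT G q f∞ T₀ o₀) (MT G q f∞ T o) w ≡ flipDiv G q f∞ o₀ o w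
  Ψ-flip-pointwise T₀ T o₀ o w o₀-on-w o-on-w
    with _≟ʰ_ G q f∞ (MT G q f∞ T₀ o₀ w) (MT G q f∞ T o w)
  ... | yes same-half-edge =
    -- both matchings use the same half-edge, which is then positive for o₀,
    -- so o agrees with o₀ on w
    cong (λ b → if b then 0ℤ else 1ℤ) (sym agree)
    where
    agree : ⌊ o w ≟ᵈ o₀ w ⌋ ≡ true
    agree = begin
        ⌊ o w ≟ᵈ o₀ w ⌋
      ≡⟨ sym (temperley-sign T o o₀ w o-on-w o₀-on-w) ⟩
        positive G q f∞ o₀ (MT G q f∞ T o w)
      ≡⟨ cong (positive G q f∞ o₀) (sym same-half-edge) ⟩
        positive G q f∞ o₀ (MT G q f∞ T₀ o₀ w)
      ≡⟨ temperley-positive T₀ o₀ w o₀-on-w ⟩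
        true
      ∎
      where open ≡-Reasoning
  ... | no _ = begin
      (if positive G q f∞ o₀ (MT G q f∞ T₀ o₀ w) xor positive G q f∞ o₀ (MT G q f∞ T o w)
        then 1ℤ else 0ℤ)
    ≡⟨ cong₂ (λ p₀ p → if p₀ xor p then 1ℤ else 0ℤ)
         (temperley-positive T₀ o₀ w o₀-on-w)
         (temperley-sign T o o₀ w o-on-w o₀-on-w) ⟩
      (if not ⌊ o w ≟ᵈ o₀ w ⌋ then 1ℤ else 0ℤ)
    ≡⟨ if-not ⌊ o w ≟ᵈ o₀ w ⌋ ⟩
      flipDiv G q f∞ o₀ o w
    ∎
    where open ≡-Reasoning

mainTheorem3 : ∀ {n m F : ℕ} (G : PlaneGraph n m F) (q : Fin n) (f∞ : Fin F) →
    OnFace G q f∞ →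
    (T₀ : Fin m → Bool) → IsSpanningTree G T₀ →
    (o₀ : Fin m → Dart m) → IsOT G q f∞ T₀ o₀ →
    (T : Fin m → Bool) → IsSpanningTree G T →
    (o : Fin m → Dart m) → IsOT G q f∞ T o →
    KEq G q f∞ o₀
      (ΨDiv G q f∞ o₀ (MT G q f∞ T₀ o₀) (MT G q f∞ T o))
      (flipDiv G q f∞ o₀ o)
mainTheorem3 G q f∞ _ T₀ _ o₀ o₀-is-OT T _ o o-is-OT =
  KEq-pointwise G q f∞ o₀ _ _ λ w →
    Ψ-flip-pointwise G q f∞ T₀ T o₀ o w (proj₁ (o₀-is-OT w)) (proj₁ (o-is-OT w))
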